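{- Let $n,\delta\in\mathbb{N}$ with $\delta\geq 3$ and $n\geq 7$. If $G$ is a connected triangle-free graph of order $n$ and minimum degree $\delta$, then \[\rho(G)-\pi(G)\leq \frac{n+1}{2\delta}+4.\]
   Context: All graphs are finite and simple. For a connected graph $G$ of order $n\ge 2$ and a vertex $v$, the average distance of $v$ is $\overline{\sigma}(v)=\frac{1}{n-1}\sum_{w\in V(G)}d(v,w)$, where $d$ is the shortest-path distance. The proximity is $\pi(G)=\min_{v\in V(G)}\overline{\sigma}(v)$ and the remoteness is $\rho(G)=\max_{v\in V(G)}\overline{\sigma}(v)$. A graph is triangle-free if it contains no $K_3$ as a subgraph. -}

module Defs where

open import Data.Bool using (Bool; true; false; if_then_else_)
open import Data.Nat using (ℕ; zero; suc; _+_; _∸_; _≤_)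
open import Data.Fin using (Fin)
open import Data.List using (List; map; foldr; allFin)
open import Data.Nat.ListAction using (sum)
open import Data.Integer using (+_)
open import Data.Rational using (ℚ; 0ℚ; _/_; _⊔_; _⊓_)
open import Data.Product using (_×_; Σ; ∃)
open import Relation.Binary.PropositionalEquality using (_≡_)
open import Relation.Nullary using (¬_)

record Graph (n : ℕ) : Set where
  field
    adj   : Fin n → Fin n → Bool
    sym   : ∀ v w → adj v w ≡ adj w v
    loopless : ∀ v → adj v v ≡ false
open Graph public

Adj : ∀ {n} → Graph n → Fin n → Fin n → Set
Adj G v w = adj G v w ≡ true

degree : ∀ {n} → Graph n → Fin n → ℕ
degree {n} G v = sum (map (λ w → if adj G v w then 1 else 0) (allFin n))

MinDegree : ∀ {n} → Graph n → ℕ → Set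
MinDegree {n} G δ = (∀ v → δ ≤ degree G v) × ∃ λ v → degree G v ≡ δ

TriangleFree : ∀ {n} → Graph n → Set
TriangleFree G = ∀ a b c → ¬ (Adj G a b × Adj G b c × Adj G a c)

data Walk {n} (G : Graph n) : Fin n → Fin n → ℕ → Set where
  here : ∀ {v} → Walk G v v 0
  step : ∀ {u v w k} → Adj G u v → Walk G v w k → Walk G u w (suc k)

Connected : ∀ {n} → Graph n → Set
Connected G = ∀ v w → ∃ λ k → Walk G v w k

IsDistance : ∀ {n} → Graph n → (Fin n → Fin n → ℕ) → Set
IsDistance G d = ∀ v w → Walk G v w (d v w) × (∀ j → Walk G v w j → d v w ≤ j)

-- a / b as a rational (0 when b = 0; only used with b ≠ 0)
ratio : ℕ → ℕ → ℚ
ratio a zero    = 0ℚ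
ratio a (suc b) = (+ a) / suc b

avgDist : ∀ {n} → (Fin n → Fin n → ℕ) → Fin n → ℚ
avgDist {n} d v = ratio (sum (map (d v) (allFin n))) (n ∸ 1)

maxOver : ∀ n → (Fin n → ℚ) → ℚ
maxOver zero    f = 0ℚ
maxOver (suc m) f = foldr _⊔_ (f Fin.zero) (map f (allFin (suc m)))

minOver : ∀ n → (Fin n → ℚ) → ℚ
minOver zero    f = 0ℚ
minOver (suc m) f = foldr _⊓_ (f Fin.zero) (map f (allFin (suc m)))

proximity : ∀ {n} → (Fin n → Fin n → ℕ) → ℚ
proximity {n} d = minOver n (avgDist d)

remoteness : ∀ {n} → (Fin n → Fin n → ℕ) → ℚ
remoteness {n} d = maxOver n (avgDist d)

module Submission where

open import Defs hiding (sym)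
open import Data.Nat using (ℕ; _≤_; _+_; _*_)
open import Data.Fin using (Fin)
open import Data.Rational using () renaming (_-_ to _-ℚ_; _+_ to _+ℚ_; _≤_ to _≤ℚ_)

open import Algebra.Definitions using (Selective)
open import Data.Bool using (true; false; if_then_else_)
open import Data.Empty using (⊥-elim)
open import Data.Integer as ℤ using (+≤+)
import Data.Integer.Properties as ℤ
open import Data.Integer.Tactic.RingSolver renaming (solve-∀ to ℤ-solve-∀) using ()
open import Data.List using (List; _∷_; []; map; foldr; length; allFin)
open import Data.List.Properties using (map-cong; length-tabulate)
open import Data.Nat using (zero; suc; _∸_; _<_; z≤n; s≤s; s≤s⁻¹; _<?_)
open import Data.Nat.ListAction using (sum)
open import Data.Nat.Properties hiding (⊔-sel; ⊓-sel)
open import Data.Nat.Tactic.RingSolver using (solve-∀)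
open import Data.Product using (_×_; _,_; proj₁; proj₂; ∃-syntax)
open import Data.Rational using (ℚ; toℚᵘ; _⊔_; _⊓_)
open import Data.Rational.Properties using (toℚᵘ-cancel-≤; toℚᵘ-homo-+; toℚᵘ-homo‿-; toℚᵘ-fromℚᵘ; ⊔-sel; ⊓-sel)
open import Data.Rational.Unnormalised as ℚᵘ using (mkℚᵘ; *≤*)
import Data.Rational.Unnormalised.Properties as ℚᵘ
open import Data.Sum using (inj₁; inj₂; [_,_]′)
open import Relation.Binary.PropositionalEquality using (_≡_; refl; sym; trans; cong; cong₂; subst; subst₂)
open import Relation.Nullary using (Dec; yes; no; ¬_)

-- Fix v, u with K = d(v,u).  Along a geodesic from v to u, every edge xy with
-- d(v,x) = j, d(v,y) = j+1 has disjoint neighbourhoods (no triangles) inside the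
-- annulus j-1 ≤ d(v,·) ≤ j+2, so the open ball of radius j+3 around v exceeds the one
-- of radius j-1 by at least 2δ.  Summing, Σ_w (K - d(v,w))⁺ ≥ δ(K² - 3K)/4, while
-- the triangle inequality gives σ(v) + 2 Σ_w (K - d(v,w))⁺ ≤ σ(u) + Kn.  Hence
-- 2δ(σ(v) - σ(u)) ≤ 2δKn - δ²K² + 3δ²K, and completing the square in δK bounds
-- this by (n-1)(n+1+8δ), which is the claim after dividing by 2δ(n-1).

module _ {A : Set} where

  sum-map-mono : ∀ {f g : A → ℕ} → (∀ x → f x ≤ g x) → ∀ xs → sum (map f xs) ≤ sum (map g xs)
  sum-map-mono f≤g []       = z≤n
  sum-map-mono f≤g (x ∷ xs) = +-mono-≤ (f≤g x) (sum-map-mono f≤g xs)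

  sum-map-+ : ∀ (f g : A → ℕ) xs → sum (map (λ x → f x + g x) xs) ≡ sum (map f xs) + sum (map g xs)
  sum-map-+ f g []       = refl
  sum-map-+ f g (x ∷ xs) = trans (cong (f x + g x +_) (sum-map-+ f g xs)) (+-+-interchange (f x) (g x) _ _)
    where
      +-+-interchange : ∀ a b c d → (a + b) + (c + d) ≡ (a + c) + (b + d)
      +-+-interchange = solve-∀

  sum-map-* : ∀ c (f : A → ℕ) xs → sum (map (λ x → c * f x) xs) ≡ c * sum (map f xs)
  sum-map-* c f []       = sym (*-zeroʳ c)
  sum-map-* c f (x ∷ xs) = trans (cong (c * f x +_) (sum-map-* c f xs)) (sym (*-distribˡ-+ c (f x) _))

  sum-map-const : ∀ c (xs : List A) → sum (map (λ _ → c) xs) ≡ c * length xs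
  sum-map-const c []       = sym (*-zeroʳ c)
  sum-map-const c (x ∷ xs) = trans (cong (c +_) (sum-map-const c xs)) (sym (*-suc c (length xs)))

sum-allFin-const : ∀ n c → sum (map (λ (_ : Fin n) → c) (allFin n)) ≡ c * n
sum-allFin-const n c = trans (sum-map-const c (allFin n)) (cong (c *_) (length-tabulate (λ i → i)))

indicator : ∀ {P : Set} → Dec P → ℕ
indicator (yes _) = 1
indicator (no _)  = 0

indicator≤1 : ∀ {P : Set} (p : Dec P) → indicator p ≤ 1
indicator≤1 (yes _) = s≤s z≤n
indicator≤1 (no _)  = z≤n

indicator-mono : ∀ {P Q : Set} → (P → Q) → (p : Dec P) (q : Dec Q) → indicator p ≤ indicator q
indicator-mono P⇒Q (yes _) (yes _) = ≤-refl
indicator-mono P⇒Q (yes P) (no ¬Q) = ⊥-elim (¬Q (P⇒Q P))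
indicator-mono P⇒Q (no _)  _       = z≤n

indicator-+1 : ∀ {P Q : Set} → ¬ P → Q → (p : Dec P) (q : Dec Q) → indicator p + 1 ≤ indicator q
indicator-+1 ¬P Q (yes P) _       = ⊥-elim (¬P P)
indicator-+1 ¬P Q (no _)  (yes _) = ≤-refl
indicator-+1 ¬P Q (no _)  (no ¬Q) = ⊥-elim (¬Q Q)

2*k+1≤2*[k∸1]+3 : ∀ k → 2 * k + 1 ≤ 2 * (k ∸ 1) + 3
2*k+1≤2*[k∸1]+3 zero    = s≤s z≤n
2*k+1≤2*[k∸1]+3 (suc k) = ≤-reflexive (shift k)
  where
    shift : ∀ k → 2 * suc k + 1 ≡ 2 * k + 3
    shift = solve-∀

suc∸≡∸+indicator : ∀ k m → suc k ∸ m ≡ k ∸ m + indicator (m <? suc k)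
suc∸≡∸+indicator k m with m <? suc k
... | yes m<1+k = trans (+-∸-assoc 1 (s≤s⁻¹ m<1+k)) (+-comm 1 (k ∸ m))
... | no  m≮1+k = trans (m≤n⇒m∸n≡0 (≮⇒≥ m≮1+k))
                        (sym (trans (+-identityʳ (k ∸ m)) (m≤n⇒m∸n≡0 (<⇒≤ (≮⇒≥ m≮1+k)))))

triangle-slack : ∀ a b c → a ≤ c + b → c ≤ a + b → a + 2 * (c ∸ a) ≤ b + c
triangle-slack a b c a≤c+b c≤a+b with ≤-total a c
... | inj₂ c≤a = begin
  a + 2 * (c ∸ a) ≡⟨ cong (λ t → a + 2 * t) (m≤n⇒m∸n≡0 c≤a) ⟩
  a + 0           ≡⟨ +-identityʳ a ⟩
  a               ≤⟨ a≤c+b ⟩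
  c + b           ≡⟨ +-comm c b ⟩
  b + c           ∎
  where open ≤-Reasoning
... | inj₁ a≤c with m≤n⇒∃[o]m+o≡n a≤c
...   | t , refl = begin
  a + 2 * (a + t ∸ a) ≡⟨ cong (λ s → a + 2 * s) (m+n∸m≡n a t) ⟩
  a + 2 * t           ≡⟨ rearrange a t ⟩
  (a + t) + t         ≤⟨ +-monoʳ-≤ (a + t) (+-cancelˡ-≤ a t b c≤a+b) ⟩
  (a + t) + b         ≡⟨ +-comm (a + t) b ⟩
  b + (a + t)         ∎
  where
    open ≤-Reasoning
    rearrange : ∀ a t → a + 2 * t ≡ (a + t) + t
    rearrange = solve-∀

2*m*n≤m*m+n*n : ∀ m n → 2 * m * n ≤ m * m + n * n
2*m*n≤m*m+n*n m n = [ ordered , flipped ]′ (≤-total m n)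
  where
    ordered : ∀ {a b} → a ≤ b → 2 * a * b ≤ a * a + b * b
    ordered {a} a≤b with m≤n⇒∃[o]m+o≡n a≤b
    ... | t , refl = ≤-trans (m≤m+n _ (t * t)) (≤-reflexive (square-gap a t))
      where
        square-gap : ∀ a t → 2 * a * (a + t) + t * t ≡ a * a + (a + t) * (a + t)
        square-gap = solve-∀
    flipped : n ≤ m → 2 * m * n ≤ m * m + n * n
    flipped n≤m = subst₂ _≤_ (swap n m) (+-comm (n * n) (m * m)) (ordered n≤m)
      where
        swap : ∀ a b → 2 * a * b ≡ 2 * b * a
        swap = solve-∀

4+12*δ+9*δ*δ≤20*δ*m : ∀ m δ → 6 ≤ m → 1 ≤ δ → δ + δ ≤ suc m → 4 + 12 * δ + 9 * (δ * δ) ≤ 20 * δ * m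
4+12*δ+9*δ*δ≤20*δ*m m δ m≥6 δ≥1 2δ≤n = *-cancelˡ-≤ 2 (begin
  2 * (4 + 12 * δ + 9 * (δ * δ))  ≡⟨ double δ ⟩
  8 + 24 * δ + 9 * (δ * (δ + δ))  ≤⟨ +-mono-≤ (+-monoˡ-≤ (24 * δ) (*-monoʳ-≤ 8 δ≥1)) (*-monoʳ-≤ 9 (*-monoʳ-≤ δ 2δ≤n)) ⟩
  8 * δ + 24 * δ + 9 * (δ * suc m) ≡⟨ collect δ m ⟩
  δ * 41 + 9 * (δ * m)            ≤⟨ +-monoˡ-≤ (9 * (δ * m)) (*-monoʳ-≤ δ (≤-trans (m≤m+n 41 145) (*-monoʳ-≤ 31 m≥6))) ⟩
  δ * (31 * m) + 9 * (δ * m)      ≡⟨ total δ m ⟩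
  2 * (20 * δ * m)                ∎)
  where
    open ≤-Reasoning
    double : ∀ δ → 2 * (4 + 12 * δ + 9 * (δ * δ)) ≡ 8 + 24 * δ + 9 * (δ * (δ + δ))
    double = solve-∀
    collect : ∀ δ m → 8 * δ + 24 * δ + 9 * (δ * suc m) ≡ δ * 41 + 9 * (δ * m)
    collect = solve-∀
    total : ∀ δ m → δ * (31 * m) + 9 * (δ * m) ≡ 2 * (20 * δ * m)
    total = solve-∀

-- Completing the square (2δK - (2n + 3δ))² ≥ 0, with n = suc m.
quadratic-bound : ∀ m δ K → 6 ≤ m → 1 ≤ δ → (1 ≤ K → δ + δ ≤ suc m) →
                  δ * (2 * K * suc m + 3 * δ * K) ≤ δ * (δ * (K * K)) + m * (suc m + 1 + 4 * (2 * δ))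
quadratic-bound m δ zero    _   _   _       = ≤-trans (≤-reflexive (vanishes m δ)) z≤n
  where
    vanishes : ∀ m δ → δ * (2 * 0 * suc m + 3 * δ * 0) ≡ 0
    vanishes = solve-∀
quadratic-bound m δ (suc k) m≥6 δ≥1 2δ≤n = *-cancelˡ-≤ 4 (begin
  4 * (δ * (2 * K * suc m + 3 * δ * K))                 ≡⟨ as-product m δ K ⟩
  2 * (2 * δ * K) * (2 * suc m + 3 * δ)                 ≤⟨ 2*m*n≤m*m+n*n (2 * δ * K) (2 * suc m + 3 * δ) ⟩
  (2 * δ * K) * (2 * δ * K) + (2 * suc m + 3 * δ) * (2 * suc m + 3 * δ)
                                                        ≡⟨ expand m δ K ⟩
  Q + (4 + 12 * δ + 9 * (δ * δ))                        ≤⟨ +-monoʳ-≤ Q (4+12*δ+9*δ*δ≤20*δ*m m δ m≥6 δ≥1 (2δ≤n (s≤s z≤n))) ⟩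
  Q + 20 * δ * m                                        ≡⟨ regroup m δ K ⟩
  4 * (δ * (δ * (K * K)) + m * (suc m + 1 + 4 * (2 * δ))) ∎)
  where
    open ≤-Reasoning
    K = suc k
    Q = 4 * (δ * (δ * (K * K))) + (4 * m * m + 8 * m + 12 * δ * m)
    as-product : ∀ m δ K → 4 * (δ * (2 * K * suc m + 3 * δ * K)) ≡ 2 * (2 * δ * K) * (2 * suc m + 3 * δ)
    as-product = solve-∀
    expand : ∀ m δ K → (2 * δ * K) * (2 * δ * K) + (2 * suc m + 3 * δ) * (2 * suc m + 3 * δ)
                       ≡ 4 * (δ * (δ * (K * K))) + (4 * m * m + 8 * m + 12 * δ * m) + (4 + 12 * δ + 9 * (δ * δ))
    expand = solve-∀
    regroup : ∀ m δ K → 4 * (δ * (δ * (K * K))) + (4 * m * m + 8 * m + 12 * δ * m) + 20 * δ * m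
                        ≡ 4 * (δ * (δ * (K * K)) + m * (suc m + 1 + 4 * (2 * δ)))
    regroup = solve-∀

gap-arithmetic : ∀ m δ K σv σu → 6 ≤ m → 1 ≤ δ → (1 ≤ K → δ + δ ≤ suc m) →
                 2 * σv + δ * (K * K) ≤ 2 * σu + (2 * K * suc m + 3 * δ * K) →
                 2 * δ * σv ≤ 2 * δ * σu + m * (suc m + 1 + 4 * (2 * δ))
gap-arithmetic m δ K σv σu m≥6 δ≥1 2δ≤n gap = +-cancelʳ-≤ (δ * (δ * (K * K))) _ _ (begin
  2 * δ * σv + δ * (δ * (K * K))        ≡⟨ factor δ σv (K * K) ⟩
  δ * (2 * σv + δ * (K * K))            ≤⟨ *-monoʳ-≤ δ gap ⟩
  δ * (2 * σu + L)                      ≡⟨ distribute δ σu L ⟩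
  2 * δ * σu + δ * L                    ≤⟨ +-monoʳ-≤ (2 * δ * σu) (quadratic-bound m δ K m≥6 δ≥1 2δ≤n) ⟩
  2 * δ * σu + (δ * (δ * (K * K)) + R)  ≡⟨ swap-last (2 * δ * σu) (δ * (δ * (K * K))) R ⟩
  2 * δ * σu + R + δ * (δ * (K * K))    ∎)
  where
    open ≤-Reasoning
    L = 2 * K * suc m + 3 * δ * K
    R = m * (suc m + 1 + 4 * (2 * δ))
    factor : ∀ δ σ S → 2 * δ * σ + δ * (δ * S) ≡ δ * (2 * σ + δ * S)
    factor = solve-∀
    distribute : ∀ δ σ L → δ * (2 * σ + L) ≡ 2 * δ * σ + δ * L
    distribute = solve-∀
    swap-last : ∀ a b c → a + (b + c) ≡ a + c + b
    swap-last = solve-∀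

mkℚᵘ-sub≤add : ∀ a b c e m k → suc k * a ≤ suc k * b + suc m * (c + e * suc k) →
               mkℚᵘ (ℤ.+ a) m ℚᵘ.- mkℚᵘ (ℤ.+ b) m ℚᵘ.≤ mkℚᵘ (ℤ.+ c) k ℚᵘ.+ mkℚᵘ (ℤ.+ e) 0
mkℚᵘ-sub≤add a b c e m k h = *≤* (subst₂ ℤ._≤_
    (cong (ℤ._*_ (A ℤ.* M ℤ.+ ℤ.- B ℤ.* M)) (sym (ℤ.pos-* (suc k) 1)))
    (cong (ℤ._*_ (C ℤ.* ℤ.+ 1 ℤ.+ E ℤ.* K)) (sym (ℤ.pos-* (suc m) (suc m)))) (begin
  (A ℤ.* M ℤ.+ ℤ.- B ℤ.* M) ℤ.* (K ℤ.* ℤ.+ 1)                      ≡⟨ lhs-form A B M K ⟩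
  M ℤ.* (K ℤ.* A) ℤ.- M ℤ.* (K ℤ.* B)                              ≤⟨ ℤ.+-monoˡ-≤ _ (ℤ.*-monoˡ-≤-nonNeg M hℤ) ⟩
  M ℤ.* (K ℤ.* B ℤ.+ M ℤ.* (C ℤ.+ E ℤ.* K)) ℤ.- M ℤ.* (K ℤ.* B)    ≡⟨ rhs-form B C E M K ⟩
  (C ℤ.* ℤ.+ 1 ℤ.+ E ℤ.* K) ℤ.* (M ℤ.* M)                          ∎))
  where
    open ℤ.≤-Reasoning
    A = ℤ.+ a
    B = ℤ.+ b
    C = ℤ.+ c
    E = ℤ.+ e
    M = ℤ.+ suc m
    K = ℤ.+ suc k
    hℤ : K ℤ.* A ℤ.≤ K ℤ.* B ℤ.+ M ℤ.* (C ℤ.+ E ℤ.* K)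
    hℤ = subst₂ ℤ._≤_ (ℤ.pos-* (suc k) a)
           (trans (ℤ.pos-+ (suc k * b) _)
             (cong₂ ℤ._+_ (ℤ.pos-* (suc k) b)
               (trans (ℤ.pos-* (suc m) _) (cong (ℤ._*_ M) (trans (ℤ.pos-+ c _) (cong (ℤ._+_ C) (ℤ.pos-* e (suc k))))))))
           (+≤+ h)
    lhs-form : ∀ A B M K → (A ℤ.* M ℤ.+ ℤ.- B ℤ.* M) ℤ.* (K ℤ.* ℤ.+ 1) ≡ M ℤ.* (K ℤ.* A) ℤ.- M ℤ.* (K ℤ.* B)
    lhs-form = ℤ-solve-∀
    rhs-form : ∀ B C E M K → M ℤ.* (K ℤ.* B ℤ.+ M ℤ.* (C ℤ.+ E ℤ.* K)) ℤ.- M ℤ.* (K ℤ.* B)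
                             ≡ (C ℤ.* ℤ.+ 1 ℤ.+ E ℤ.* K) ℤ.* (M ℤ.* M)
    rhs-form = ℤ-solve-∀

ratio-sub≤add : ∀ a b c e m k → suc k * a ≤ suc k * b + suc m * (c + e * suc k) →
                ratio a (suc m) -ℚ ratio b (suc m) ≤ℚ ratio c (suc k) +ℚ ratio e 1
ratio-sub≤add a b c e m k h = toℚᵘ-cancel-≤ (begin
  toℚᵘ (ratio a (suc m) -ℚ ratio b (suc m))
    ≃⟨ ℚᵘ.≃-trans (toℚᵘ-homo-+ (ratio a (suc m)) _)
         (ℚᵘ.+-cong (toℚᵘ-fromℚᵘ (mkℚᵘ (ℤ.+ a) m))
           (ℚᵘ.≃-trans (toℚᵘ-homo‿- (ratio b (suc m))) (ℚᵘ.-‿cong (toℚᵘ-fromℚᵘ (mkℚᵘ (ℤ.+ b) m))))) ⟩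
  mkℚᵘ (ℤ.+ a) m ℚᵘ.- mkℚᵘ (ℤ.+ b) m
    ≤⟨ mkℚᵘ-sub≤add a b c e m k h ⟩
  mkℚᵘ (ℤ.+ c) k ℚᵘ.+ mkℚᵘ (ℤ.+ e) 0
    ≃⟨ ℚᵘ.≃-sym (ℚᵘ.≃-trans (toℚᵘ-homo-+ (ratio c (suc k)) _)
         (ℚᵘ.+-cong (toℚᵘ-fromℚᵘ (mkℚᵘ (ℤ.+ c) k)) (toℚᵘ-fromℚᵘ (mkℚᵘ (ℤ.+ e) 0)))) ⟩
  toℚᵘ (ratio c (suc k) +ℚ ratio e 1) ∎)
  where open ℚᵘ.≤-Reasoning

foldr-map-attained : ∀ {A B : Set} (_∙_ : B → B → B) → Selective _≡_ _∙_ → (f : A → B) →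
                     ∀ {z} xs → ∃[ a ] z ≡ f a → ∃[ a ] foldr _∙_ z (map f xs) ≡ f a
foldr-map-attained _∙_ sel f []       z≡fa = z≡fa
foldr-map-attained _∙_ sel f (x ∷ xs) z≡fa with sel (f x) (foldr _∙_ _ (map f xs))
... | inj₁ ≡fx = x , ≡fx
... | inj₂ ≡rest with foldr-map-attained _∙_ sel f xs z≡fa
...   | a , rest≡fa = a , trans ≡rest rest≡fa

maxOver-attained : ∀ m (f : Fin (suc m) → ℚ) → ∃[ v ] maxOver (suc m) f ≡ f v
maxOver-attained m f = foldr-map-attained _⊔_ ⊔-sel f (allFin (suc m)) (Fin.zero , refl)

minOver-attained : ∀ m (f : Fin (suc m) → ℚ) → ∃[ v ] minOver (suc m) f ≡ f v
minOver-attained m f = foldr-map-attained _⊓_ ⊓-sel f (allFin (suc m)) (Fin.zero , refl)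

module Walks {n} (G : Graph n) where

  Adj-sym : ∀ {v w} → Adj G v w → Adj G w v
  Adj-sym {v} {w} v~w = trans (Graph.sym G w v) v~w

  _++ʷ_ : ∀ {u v w a b} → Walk G u v a → Walk G v w b → Walk G u w (a + b)
  here       ++ʷ q = q
  step u~x p ++ʷ q = step u~x (p ++ʷ q)

  reverse : ∀ {u v k} → Walk G u v k → Walk G v u k
  reverse here                = here
  reverse (step {k = k} u~x p) = subst (Walk G _ _) (+-comm k 1) (reverse p ++ʷ step (Adj-sym u~x) here)

module Distance {n} (G : Graph n) (d : Fin n → Fin n → ℕ) (isDist : IsDistance G d) where
  open Walks G

  geodesic : ∀ v w → Walk G v w (d v w)
  geodesic v w = proj₁ (isDist v w)

  d-minimal : ∀ {v w j} → Walk G v w j → d v w ≤ j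
  d-minimal {v} {w} {j} p = proj₂ (isDist v w) j p

  transmission : Fin n → ℕ
  transmission v = sum (map (d v) (allFin n))

  d-sym : ∀ v w → d v w ≡ d w v
  d-sym v w = ≤-antisym (d-minimal (reverse (geodesic w v))) (d-minimal (reverse (geodesic v w)))

  d-triangle : ∀ v x w → d v w ≤ d v x + d x w
  d-triangle v x w = d-minimal (geodesic v x ++ʷ geodesic x w)

  d-adj : ∀ v {x w} → Adj G x w → d v w ≤ suc (d v x)
  d-adj v {x} x~w = d-minimal (subst (Walk G _ _) (+-comm (d v x) 1) (geodesic v x ++ʷ step x~w here))

  geodesic-predecessor : ∀ {v y j} → d v y ≡ suc j → ∃[ x ] Adj G x y × d v x ≡ j
  geodesic-predecessor {v} {y} dy with reverse (subst (Walk G v y) dy (geodesic v y))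
  ... | step {v = x} y~x x→v =
        x , Adj-sym y~x , ≤-antisym (d-minimal (reverse x→v)) (s≤s⁻¹ (subst (_≤ suc (d v x)) dy (d-adj v (Adj-sym y~x))))

  level-inhabited : ∀ {v y} m t → d v y ≡ m + t → ∃[ z ] d v z ≡ m
  level-inhabited {y = y} m zero    dy = y , trans dy (+-identityʳ m)
  level-inhabited         m (suc t) dy with geodesic-predecessor (trans dy (+-suc m t))
  ... | x , _ , dx = level-inhabited m t dx

  level-edge : ∀ {v u} j → suc j ≤ d v u → ∃[ x ] ∃[ y ] Adj G x y × d v x ≡ j × d v y ≡ suc j
  level-edge {v} {u} j j<K with level-inhabited (suc j) (d v u ∸ suc j) (sym (m+[n∸m]≡n j<K))
  ... | y , dy with geodesic-predecessor dy
  ...   | x , x~y , dx = x , y , x~y , dx , dy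

module Ball {n} (G : Graph n) (d : Fin n → Fin n → ℕ) (isDist : IsDistance G d) (v : Fin n) where
  open Walks G
  open Distance G d isDist

  ball : ℕ → ℕ
  ball r = sum (map (λ w → indicator (d v w <? r)) (allFin n))

  ball≤n : ∀ r → ball r ≤ n
  ball≤n r = ≤-trans (sum-map-mono (λ w → indicator≤1 (d v w <? r)) (allFin n))
                     (≤-reflexive (trans (sum-allFin-const n 1) (*-identityˡ n)))

  deficit : ℕ → ℕ
  deficit k = sum (map (λ w → k ∸ d v w) (allFin n))

  deficit-suc : ∀ k → deficit (suc k) ≡ deficit k + ball (suc k)
  deficit-suc k = trans (cong sum (map-cong (λ w → suc∸≡∸+indicator k (d v w)) (allFin n)))
                        (sum-map-+ (λ w → k ∸ d v w) (λ w → indicator (d v w <? suc k)) (allFin n))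

  adjacency : Fin n → Fin n → ℕ
  adjacency x w = if adj G x w then 1 else 0

  neighbour-in-annulus : ∀ {z w j} → Adj G z w → j ≤ d v z → d v z ≤ suc j → j ∸ 1 ≤ d v w × d v w < 3 + j
  neighbour-in-annulus {j = j} z~w j≤dz dz≤1+j =
    m≤n+o⇒m∸n≤o j 1 (≤-trans j≤dz (d-adj v (Adj-sym z~w))) , s≤s (≤-trans (d-adj v z~w) (s≤s dz≤1+j))

  indicator-annulus : ∀ {w j} → j ∸ 1 ≤ d v w × d v w < 3 + j →
                      indicator (d v w <? j ∸ 1) + 1 ≤ indicator (d v w <? 3 + j)
  indicator-annulus (lo , hi) = indicator-+1 (≤⇒≯ lo) hi _ _

  edge-in-annulus : TriangleFree G → ∀ {x y j} → Adj G x y → d v x ≡ j → d v y ≡ suc j → ∀ w →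
                    indicator (d v w <? j ∸ 1) + (adjacency x w + adjacency y w) ≤ indicator (d v w <? 3 + j)
  edge-in-annulus tf {x} {y} {j} x~y dx dy w with adj G x w in x~w | adj G y w in y~w
  ... | true  | true  = ⊥-elim (tf x y w (x~y , y~w , x~w))
  ... | true  | false = indicator-annulus (neighbour-in-annulus x~w (≤-reflexive (sym dx)) (≤-trans (≤-reflexive dx) (n≤1+n j)))
  ... | false | true  = indicator-annulus (neighbour-in-annulus y~w (≤-trans (n≤1+n j) (≤-reflexive (sym dy))) (≤-reflexive dy))
  ... | false | false = ≤-trans (≤-reflexive (+-identityʳ _))
                          (indicator-mono (λ w<j-1 → <-≤-trans w<j-1 (≤-trans (m∸n≤m j 1) (m≤n+m j 3))) _ _)

  ball+degrees≤ball : TriangleFree G → ∀ {x y j} → Adj G x y → d v x ≡ j → d v y ≡ suc j →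
                      ball (j ∸ 1) + (degree G x + degree G y) ≤ ball (3 + j)
  ball+degrees≤ball tf {x} {y} {j} x~y dx dy = begin
    ball (j ∸ 1) + (degree G x + degree G y)
      ≡⟨ cong (ball (j ∸ 1) +_) (sym (sum-map-+ (adjacency x) (adjacency y) (allFin n))) ⟩
    ball (j ∸ 1) + sum (map (λ w → adjacency x w + adjacency y w) (allFin n))
      ≡⟨ sym (sum-map-+ (λ w → indicator (d v w <? j ∸ 1)) _ (allFin n)) ⟩
    sum (map (λ w → indicator (d v w <? j ∸ 1) + (adjacency x w + adjacency y w)) (allFin n))
      ≤⟨ sum-map-mono (edge-in-annulus tf x~y dx dy) (allFin n) ⟩
    ball (3 + j) ∎
    where open ≤-Reasoning

  transmission-deficit : ∀ u → transmission v + 2 * deficit (d v u) ≤ transmission u + d v u * n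
  transmission-deficit u = begin
    transmission v + 2 * deficit K
      ≡⟨ cong (transmission v +_) (sym (sum-map-* 2 (λ w → K ∸ d v w) (allFin n))) ⟩
    transmission v + sum (map (λ w → 2 * (K ∸ d v w)) (allFin n))
      ≡⟨ sym (sum-map-+ (d v) _ (allFin n)) ⟩
    sum (map (λ w → d v w + 2 * (K ∸ d v w)) (allFin n))
      ≤⟨ sum-map-mono slack (allFin n) ⟩
    sum (map (λ w → d u w + K) (allFin n))
      ≡⟨ sum-map-+ (d u) (λ _ → K) (allFin n) ⟩
    transmission u + sum (map (λ _ → K) (allFin n))
      ≡⟨ cong (transmission u +_) (sum-allFin-const n K) ⟩
    transmission u + K * n ∎
    where
      open ≤-Reasoning
      K = d v u
      slack : ∀ w → d v w + 2 * (K ∸ d v w) ≤ d u w + K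
      slack w = triangle-slack (d v w) (d u w) K (d-triangle v u w)
                  (≤-trans (d-triangle v w u) (≤-reflexive (cong (d v w +_) (d-sym w u))))

  module Growth (tf : TriangleFree G) (δ : ℕ) (minDeg : ∀ x → δ ≤ degree G x) (u : Fin n) where

    ball-step : ∀ j → suc j ≤ d v u → ball (j ∸ 1) + (δ + δ) ≤ ball (3 + j)
    ball-step j j<K with level-edge j j<K
    ... | x , y , x~y , dx , dy =
          ≤-trans (+-monoʳ-≤ (ball (j ∸ 1)) (+-mono-≤ (minDeg x) (minDeg y))) (ball+degrees≤ball tf x~y dx dy)

    δ+δ≤n : 1 ≤ d v u → δ + δ ≤ n
    δ+δ≤n 1≤K = ≤-trans (m≤n+m (δ + δ) (ball 0)) (≤-trans (ball-step 0 1≤K) (ball≤n 3))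

    ball-growth : ∀ r → r ≤ 2 + d v u → δ * (r ∸ 2) ≤ 2 * ball r
    ball-growth 0 _ = ≤-trans (≤-reflexive (*-zeroʳ δ)) z≤n
    ball-growth 1 _ = ≤-trans (≤-reflexive (*-zeroʳ δ)) z≤n
    ball-growth 2 _ = ≤-trans (≤-reflexive (*-zeroʳ δ)) z≤n
    ball-growth 3 (s≤s (s≤s 1≤K)) = begin
      δ * 1                          ≡⟨ *-identityʳ δ ⟩
      δ                              ≤⟨ m≤m+n δ (2 * ball 0 + 3 * δ) ⟩
      δ + (2 * ball 0 + 3 * δ)       ≡⟨ regroup δ (ball 0) ⟩
      2 * (ball 0 + (δ + δ))         ≤⟨ *-monoʳ-≤ 2 (ball-step 0 1≤K) ⟩
      2 * ball 3                     ∎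
      where
        open ≤-Reasoning
        regroup : ∀ δ b → δ + (2 * b + 3 * δ) ≡ 2 * (b + (δ + δ))
        regroup = solve-∀
    ball-growth (suc (suc (suc (suc r)))) r+4≤2+K@(s≤s (s≤s r+2≤K)) = begin
      δ * (2 + r)                    ≤⟨ *-monoʳ-≤ δ (+-monoʳ-≤ 2 (m≤n+m∸n r 2)) ⟩
      δ * (2 + (2 + (r ∸ 2)))        ≡⟨ regroup δ (r ∸ 2) ⟩
      δ * (r ∸ 2) + 2 * (δ + δ)      ≤⟨ +-monoˡ-≤ (2 * (δ + δ)) (ball-growth r (≤-trans (m≤n+m r 4) r+4≤2+K)) ⟩
      2 * ball r + 2 * (δ + δ)       ≡⟨ sym (*-distribˡ-+ 2 (ball r) (δ + δ)) ⟩
      2 * (ball r + (δ + δ))         ≤⟨ *-monoʳ-≤ 2 (ball-step (suc r) r+2≤K) ⟩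
      2 * ball (4 + r)               ∎
      where
        open ≤-Reasoning
        regroup : ∀ δ t → δ * (2 + (2 + t)) ≡ δ * t + 2 * (δ + δ)
        regroup = solve-∀

    deficit-square : ∀ k → k ≤ d v u → δ * (k * k) ≤ 4 * deficit k + 3 * δ * k
    deficit-square zero    _   = ≤-trans (≤-reflexive (*-zeroʳ δ)) z≤n
    deficit-square (suc k) k<K = begin
      δ * (suc k * suc k)                                      ≡⟨ square-suc δ k ⟩
      δ * (k * k) + δ * (2 * k + 1)                            ≤⟨ +-mono-≤ (deficit-square k (<⇒≤ k<K)) (*-monoʳ-≤ δ (2*k+1≤2*[k∸1]+3 k)) ⟩
      4 * deficit k + 3 * δ * k + δ * (2 * (k ∸ 1) + 3)        ≡⟨ regroup (deficit k) δ k (k ∸ 1) ⟩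
      4 * deficit k + 2 * (δ * (k ∸ 1)) + 3 * δ * suc k
        ≤⟨ +-monoˡ-≤ (3 * δ * suc k) (+-monoʳ-≤ (4 * deficit k) (*-monoʳ-≤ 2 growth)) ⟩
      4 * deficit k + 2 * (2 * ball (suc k)) + 3 * δ * suc k   ≡⟨ collect (deficit k) (ball (suc k)) (3 * δ * suc k) ⟩
      4 * (deficit k + ball (suc k)) + 3 * δ * suc k           ≡⟨ cong (λ t → 4 * t + 3 * δ * suc k) (sym (deficit-suc k)) ⟩
      4 * deficit (suc k) + 3 * δ * suc k                      ∎
      where
        open ≤-Reasoning
        growth : δ * (k ∸ 1) ≤ 2 * ball (suc k)
        growth = ball-growth (suc k) (≤-trans k<K (m≤n+m _ 2))
        square-suc : ∀ δ k → δ * (suc k * suc k) ≡ δ * (k * k) + δ * (2 * k + 1)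
        square-suc = solve-∀
        regroup : ∀ D δ k t → 4 * D + 3 * δ * k + δ * (2 * t + 3) ≡ 4 * D + 2 * (δ * t) + 3 * δ * suc k
        regroup = solve-∀
        collect : ∀ D b c → 4 * D + 2 * (2 * b) + c ≡ 4 * (D + b) + c
        collect = solve-∀

    transmission-difference : 2 * transmission v + δ * (d v u * d v u) ≤ 2 * transmission u + (2 * d v u * n + 3 * δ * d v u)
    transmission-difference = begin
      2 * σv + δ * (K * K)           ≤⟨ +-monoʳ-≤ (2 * σv) (deficit-square K ≤-refl) ⟩
      2 * σv + (4 * D + 3 * δ * K)   ≡⟨ factor σv D (3 * δ * K) ⟩
      2 * (σv + 2 * D) + 3 * δ * K   ≤⟨ +-monoˡ-≤ (3 * δ * K) (*-monoʳ-≤ 2 (transmission-deficit u)) ⟩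
      2 * (σu + K * n) + 3 * δ * K   ≡⟨ distribute σu K n (3 * δ * K) ⟩
      2 * σu + (2 * K * n + 3 * δ * K) ∎
      where
        open ≤-Reasoning
        σv = transmission v
        σu = transmission u
        K = d v u
        D = deficit K
        factor : ∀ σ D c → 2 * σ + (4 * D + c) ≡ 2 * (σ + 2 * D) + c
        factor = solve-∀
        distribute : ∀ σ K n c → 2 * (σ + K * n) + c ≡ 2 * σ + (2 * K * n + c)
        distribute = solve-∀

avgDist-gap : ∀ {n} δ (G : Graph n) → 1 ≤ δ → 7 ≤ n → TriangleFree G → (∀ x → δ ≤ degree G x) →
              (d : Fin n → Fin n → ℕ) → IsDistance G d → ∀ v u →
              (avgDist d v -ℚ avgDist d u) ≤ℚ (ratio (n + 1) (2 * δ) +ℚ ratio 4 1)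
avgDist-gap {n@(suc (suc m))} δ G (s≤s z≤n) (s≤s n-1≥6) tf minDeg d isDist v u =
  ratio-sub≤add (transmission v) (transmission u) (n + 1) 4 m _
    (gap-arithmetic (suc m) δ (d v u) (transmission v) (transmission u) n-1≥6 (s≤s z≤n) δ+δ≤n transmission-difference)
  where
    open Distance G d isDist
    open Ball.Growth G d isDist v tf δ minDeg u

theorem3p1 : (n δ : ℕ) → 3 ≤ δ → 7 ≤ n → (G : Graph n) → Connected G → TriangleFree G → MinDegree G δ
    → (d : Fin n → Fin n → ℕ) → IsDistance G d
    → (remoteness d -ℚ proximity d) ≤ℚ (ratio (n + 1) (2 * δ) +ℚ ratio 4 1)
theorem3p1 (suc m) δ δ≥3 n≥7 G _ tf (minDeg , _) d isDist
  with maxOver-attained m (avgDist d) | minOver-attained m (avgDist d)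
... | v , max≡σv | u , min≡σu =
  subst₂ (λ p q → (p -ℚ q) ≤ℚ (ratio (suc m + 1) (2 * δ) +ℚ ratio 4 1)) (sym max≡σv) (sym min≡σu)
    (avgDist-gap δ G (≤-trans (s≤s z≤n) δ≥3) n≥7 tf minDeg d isDist v u)
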